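{- Let $\alpha$ be any declarative of $\mathcal L_{\Rrightarrow\odot}$. For every neighborhood model $M$ and every world $w$ of $M$: $M,w\models\alpha$ if and only if $M,w\models_{\mathsf{INL}}\alpha^\star$.
   Context: Fix a set $\mathcal P$ of atoms. A neighborhood model is $M=\langle W,\Sigma,V\rangle$ with $W$ nonempty, $\Sigma(w)$ an arbitrary set of subsets of $W$ (the empty set allowed), $V:W\times\mathcal P\to\{0,1\}$. The language $\mathcal L_{\Rrightarrow\odot}$: $\varphi ::= p \mid \bot \mid \odot \mid (\varphi\wedge\varphi)\mid(\varphi\to\varphi)\mid(\varphi\veebar\varphi)\mid(\varphi\Rrightarrow\varphi)$, with $\veebar$ inquisitive disjunction; $\neg\varphi:=\varphi\to\bot$. A declarative is a formula in which every occurrence of $\veebar$ lies within an argument of some occurrence of $\Rrightarrow$. Support at $s\subseteq W$: $M,s\models p$ iff $V(w,p)=1$ for all $w\in s$; $M,s\models\bot$ iff $s=\emptyset$; $M,s\models\odot$ iff $\emptyset\in\Sigma(w)$ for all $w\in s$; $\wedge$ conjunctively; $M,s\models\varphi\veebar\psi$ iff $M,s\models\varphi$ or $M,s\models\psi$; $M,s\models\varphi\to\psi$ iff for all $t\subseteq s$, $M,t\models\varphi$ implies $M,t\models\psi$; $M,s\models\varphi\Rrightarrow\psi$ iff for all $w\in s$, $t\in\Sigma(w)$, $M,t\models\varphi$ implies $M,t\models\psi$. Truth: $M,w\models\varphi$ iff $M,\{w\}\models\varphi$. Resolutions: $\mathcal R(\varphi)=\{\varphi\}$ if $\varphi$ is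 an atom, $\bot$, $\odot$ or of the form $\psi\Rrightarrow\chi$; $\mathcal R(\varphi\wedge\psi)=\{\alpha\wedge\beta:\alpha\in\mathcal R(\varphi),\beta\in\mathcal R(\psi)\}$; $\mathcal R(\varphi\veebar\psi)=\mathcal R(\varphi)\cup\mathcal R(\psi)$; $\mathcal R(\varphi\to\psi)=\{\bigwedge_{\alpha\in\mathcal R(\varphi)}(\alpha\to f(\alpha)): f:\mathcal R(\varphi)\to\mathcal R(\psi)\}$. Instantial neighborhood logic: $\mathcal L_{\mathsf{INL}}$ has $\sigma ::= p\mid\neg\sigma\mid(\sigma\wedge\sigma)\mid\Box(\rho_1,\dots,\rho_n;\sigma)$ ($n\ge0$), with classical clauses for $\neg,\wedge$ and $M,w\models_{\mathsf{INL}}\Box(\rho_1,\dots,\rho_n;\sigma)$ iff there is $s\in\Sigma(w)$ with $M,v\models_{\mathsf{INL}}\sigma$ for all $v\in s$ and, for each $i\le n$, some $v\in s$ with $M,v\models_{\mathsf{INL}}\rho_i$. Translation $(\cdot)^\star$ from declaratives of $\mathcal L_{\Rrightarrow\odot}$ to $\mathcal L_{\mathsf{INL}}$ (well-defined by recursion on modal depth, then subformulas): $p^\star=p$; $\bot^\star=p_0\wedge\neg p_0$ for a fixed $p_0\in\mathcal P$; $(\alpha\wedge\beta)^\star=\alpha^\star\wedge\beta^\star$; $(\alpha\to\beta)^\star=\neg(\alpha^\star\wedge\neg\beta^\star)$; $\odot^\star=\Box(;\bot^\star)$; $(\varphi\Rrightarrow\psi)^\star=\bigwedge_{i=1}^n\neg\Box(\neg\beta_1^\star,\dots,\neg\beta_m^\star;\alpha_i^\star)$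 where $\{\alpha_1,\dots,\alpha_n\}=\mathcal R(\varphi)$ and $\{\beta_1,\dots,\beta_m\}=\mathcal R(\psi)$. -}

module Defs where

open import Level using (Level; 0ℓ; Lift) renaming (suc to lsuc)
open import Data.Nat using (ℕ; zero; suc; _⊔_)
open import Data.Bool using (Bool; true)
open import Data.List using (List; []; _∷_; _++_; map; concatMap)
open import Data.Product using (Σ; ∃; _×_; _,_)
open import Data.Sum using (_⊎_)
open import Data.Empty using (⊥)
open import Relation.Nullary using (¬_)
open import Relation.Unary using (Pred; _⊆_)
open import Relation.Binary.PropositionalEquality using (_≡_)

infixr 6 _∧_
infixr 5 _⩒_
infixr 4 _⇒_ _⇛_

data Form (Atom : Set) : Set where
  atom : Atom → Form Atom
  ⊥f   : Form Atom
  ⊙    : Form Atom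
  _∧_  : Form Atom → Form Atom → Form Atom
  _⇒_  : Form Atom → Form Atom → Form Atom
  _⩒_  : Form Atom → Form Atom → Form Atom
  _⇛_  : Form Atom → Form Atom → Form Atom

-- declaratives: every ⩒ lies within an argument of some ⇛
data Declarative {Atom : Set} : Form Atom → Set where
  d-atom : ∀ p → Declarative (atom p)
  d-⊥    : Declarative ⊥f
  d-⊙    : Declarative ⊙
  d-∧    : ∀ {φ ψ} → Declarative φ → Declarative ψ → Declarative (φ ∧ ψ)
  d-⇒    : ∀ {φ ψ} → Declarative φ → Declarative ψ → Declarative (φ ⇒ ψ)
  d-⇛    : ∀ φ ψ → Declarative (φ ⇛ ψ)

record Model (Atom : Set) : Set₁ where
  field
    W : Set
    N : W → Pred (Pred W 0ℓ) 0ℓ       -- Σ(w), an arbitrary set of subsets of W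
    V : W → Atom → Bool

open Model public

-- "∅ ∈ Σ(w)": some member of Σ(w) is empty
EmptyIn : ∀ {Atom} (M : Model Atom) → W M → Set₁
EmptyIn M w = ∃ λ (t : Pred (W M) 0ℓ) → N M w t × Lift (lsuc 0ℓ) (∀ v → ¬ t v)

_,_⊩_ : ∀ {Atom} (M : Model Atom) → Pred (W M) 0ℓ → Form Atom → Set₁
M , s ⊩ atom p = Lift (lsuc 0ℓ) (∀ w → s w → V M w p ≡ true)
M , s ⊩ ⊥f     = Lift (lsuc 0ℓ) (∀ w → ¬ s w)
M , s ⊩ ⊙      = ∀ w → s w → EmptyIn M w
M , s ⊩ (φ ∧ ψ) = (M , s ⊩ φ) × (M , s ⊩ ψ)
M , s ⊩ (φ ⩒ ψ) = (M , s ⊩ φ) ⊎ (M , s ⊩ ψ)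
M , s ⊩ (φ ⇒ ψ) = ∀ (t : Pred (W M) 0ℓ) → t ⊆ s → M , t ⊩ φ → M , t ⊩ ψ
M , s ⊩ (φ ⇛ ψ) = ∀ w → s w → ∀ (t : Pred (W M) 0ℓ) → N M w t → M , t ⊩ φ → M , t ⊩ ψ

⟦_⟧ : ∀ {A : Set} → A → Pred A 0ℓ
⟦ w ⟧ = λ v → v ≡ w

_,_⊨_ : ∀ {Atom} (M : Model Atom) → W M → Form Atom → Set₁
M , w ⊨ φ = M , ⟦ w ⟧ ⊩ φ

-- Resolutions (finite sets represented as lists)

⋀F : ∀ {Atom} → List (Form Atom) → Form Atom
⋀F []       = ⊥f ⇒ ⊥f            -- never used: resolution sets are nonempty
⋀F (x ∷ []) = x
⋀F (x ∷ xs) = x ∧ ⋀F xs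

-- all functions from (the positions of) the first list to the second, as graphs
choices : ∀ {A B : Set} → List A → List B → List (List (A × B))
choices []       bs = [] ∷ []
choices (a ∷ as) bs = concatMap (λ b → map ((a , b) ∷_) (choices as bs)) bs

ℛ : ∀ {Atom} → Form Atom → List (Form Atom)
ℛ (atom p)  = atom p ∷ []
ℛ ⊥f        = ⊥f ∷ []
ℛ ⊙         = ⊙ ∷ []
ℛ (φ ⇛ ψ)   = (φ ⇛ ψ) ∷ []
ℛ (φ ∧ ψ)   = concatMap (λ a → map (a ∧_) (ℛ ψ)) (ℛ φ)
ℛ (φ ⩒ ψ)   = ℛ φ ++ ℛ ψ
ℛ (φ ⇒ ψ)   = map (λ g → ⋀F (map (λ { (a , b) → a ⇒ b }) g)) (choices (ℛ φ) (ℛ ψ))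

data INL (Atom : Set) : Set where
  iatom : Atom → INL Atom
  ¬i    : INL Atom → INL Atom
  _∧i_  : INL Atom → INL Atom → INL Atom
  □     : List (INL Atom) → INL Atom → INL Atom

mutual
  _,_⊨I_ : ∀ {Atom} (M : Model Atom) → W M → INL Atom → Set₁
  M , w ⊨I iatom p  = Lift (lsuc 0ℓ) (V M w p ≡ true)
  M , w ⊨I ¬i σ     = ¬ (M , w ⊨I σ)
  M , w ⊨I (σ ∧i τ) = (M , w ⊨I σ) × (M , w ⊨I τ)
  M , w ⊨I □ ρs σ   = ∃ λ (s : Pred (W M) 0ℓ) →
                        N M w s × (∀ v → s v → M , v ⊨I σ) × Instances M s ρs

  Instances : ∀ {Atom} (M : Model Atom) → Pred (W M) 0ℓ → List (INL Atom) → Set₁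
  Instances M s []       = Lift (lsuc 0ℓ) Data.Unit.⊤
    where import Data.Unit
  Instances M s (ρ ∷ ρs) = (∃ λ v → s v × M , v ⊨I ρ) × Instances M s ρs

module _ {Atom : Set} (p₀ : Atom) where

  ⊥⋆ : INL Atom
  ⊥⋆ = iatom p₀ ∧i ¬i (iatom p₀)

  ⋀I : List (INL Atom) → INL Atom
  ⋀I []       = ¬i ⊥⋆             -- never used: resolution sets are nonempty
  ⋀I (x ∷ []) = x
  ⋀I (x ∷ xs) = x ∧i ⋀I xs

  md : Form Atom → ℕ
  md (atom p) = 0
  md ⊥f       = 0
  md ⊙        = 0
  md (φ ∧ ψ)  = md φ ⊔ md ψ
  md (φ ⇒ ψ)  = md φ ⊔ md ψ
  md (φ ⩒ ψ)  = md φ ⊔ md ψ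
  md (φ ⇛ ψ)  = suc (md φ ⊔ md ψ)

  -- recursion on modal depth (fuel n), then on subformulas;
  -- the ⩒ clause and the fuel-0 ⇛ clause are never reached for declaratives
  tr : ℕ → Form Atom → INL Atom
  tr n (atom p)        = iatom p
  tr n ⊥f              = ⊥⋆
  tr n ⊙               = □ [] ⊥⋆
  tr n (φ ∧ ψ)         = tr n φ ∧i tr n ψ
  tr n (φ ⇒ ψ)         = ¬i (tr n φ ∧i ¬i (tr n ψ))
  tr n (φ ⩒ ψ)         = ⊥⋆
  tr zero (φ ⇛ ψ)      = ⊥⋆
  tr (suc n) (φ ⇛ ψ)   =
    ⋀I (map (λ α → ¬i (□ (map (λ β → ¬i (tr n β)) (ℛ ψ)) (tr n α))) (ℛ φ))

  _⋆ : Form Atom → INL Atom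
  φ ⋆ = tr (md φ) φ

{-# OPTIONS --safe #-}
module Submission where

-- Declaratives are truth-conditional: a state supports α iff each of its worlds satisfies α.
-- Every formula is supported exactly where one of its resolutions is; for implications this is
-- classical, via the restriction of a state to the worlds at which a given resolution is true.
-- Hence w ⊨ φ ⇛ ψ says that no neighbourhood t of w supports a resolution α of φ without
-- supporting ψ. By truth-conditionality, t supports α iff all its worlds satisfy α⋆, and t fails
-- to support ψ iff, for each resolution β of ψ, some world of t satisfies ¬β⋆: this is
-- ¬ □(¬β₁⋆, …, ¬βₘ⋆; α⋆).

open import Defs
open import Level using (Level; 0ℓ; lift; lower) renaming (suc to lsuc)
open import Axiom.ExcludedMiddle using (ExcludedMiddle)
open import Function using (id; _∘′_)
open import Function.Bundles using (_⇔_; mk⇔; Equivalence)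
import Function.Properties.Equivalence as ⇔
open import Function.Properties.Equivalence using (⇔-setoid)
open import Function.Properties.Inverse using (↔⇒⇔)
open import Function.Related.TypeIsomorphisms using (→-cong-⇔; ¬-cong-⇔)
open import Data.Product.Function.NonDependent.Propositional using (_×-⇔_)
open import Data.Sum.Function.Propositional using (_⊎-⇔_)
open import Data.Product.Function.Dependent.Propositional using () renaming (congˡ to ∃-cong)
open import Function.Related.Propositional using (equivalence)
open import Data.Nat using (ℕ; suc; _≤_; z≤n; s≤s)
open import Data.Nat.Properties
  using (≤-refl; ≤-trans; ⊔-lub; ⊔-mono-≤; m≤m⊔n; m≤n⊔m; m⊔n≤o⇒m≤o; m⊔n≤o⇒n≤o)
open import Data.List using (List; []; _∷_; map; concatMap)
open import Data.List.Membership.Propositional using (_∈_; find; lose)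
open import Data.List.Relation.Unary.All as All using (All; []; _∷_)
import Data.List.Relation.Unary.All.Properties as Allₚ
open import Data.List.Relation.Unary.Any as Any using (Any; here)
import Data.List.Relation.Unary.Any.Properties as Anyₚ
open import Data.Product using (∃-syntax; _×_; _,_; proj₁; proj₂; uncurry)
import Data.Sum as Sum
open import Data.Empty using (⊥-elim)
open import Data.Unit using (tt)
open import Relation.Nullary using (¬_)
open import Relation.Nullary.Decidable using (True; toWitness; fromWitness; decidable-stable)
open import Relation.Unary using (Pred; _⊆_; _⟨×⟩_)
open import Relation.Binary.PropositionalEquality using (refl; sym; subst)
import Relation.Binary.Reasoning.Setoid

open Equivalence using (to; from)

module ⇔-Reasoning {ℓ} = Relation.Binary.Reasoning.Setoid (⇔-setoid ℓ)
open ⇔-Reasoning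

private
  variable
    a b c p q r : Level
    A : Set a
    B : Set b
    C : Set c

Any-cong⇔ : {P Q : Pred A p} {xs : List A} → (∀ {x} → P x ⇔ Q x) → Any P xs ⇔ Any Q xs
Any-cong⇔ P⇔Q = mk⇔ (Any.map (to P⇔Q)) (Any.map (from P⇔Q))

All-cong∈⇔ : {P Q : Pred A p} {xs : List A} → (∀ {x} → x ∈ xs → P x ⇔ Q x) → All P xs ⇔ All Q xs
All-cong∈⇔ P⇔Q = mk⇔ (λ ps → All.tabulate λ x∈ → to (P⇔Q x∈) (All.lookup ps x∈))
                     (λ qs → All.tabulate λ x∈ → from (P⇔Q x∈) (All.lookup qs x∈))

All-∷⇔ : {P : Pred A p} {x : A} {xs : List A} → All P (x ∷ xs) ⇔ (P x × All P xs)
All-∷⇔ = mk⇔ All.uncons (uncurry _∷_)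

All-map⇔ : {P : Pred B p} {f : A → B} {xs : List A} → All (λ x → P (f x)) xs ⇔ All P (map f xs)
All-map⇔ = mk⇔ Allₚ.map⁺ Allₚ.map⁻

All¬⇔¬Any : {P : Pred A p} {xs : List A} → All (λ x → ¬ P x) xs ⇔ (¬ Any P xs)
All¬⇔¬Any {xs = xs} = mk⇔ Allₚ.All¬⇒¬Any (Allₚ.¬Any⇒All¬ xs)

All-concatMap-map⁺ : {P : Pred A p} {Q : Pred B q} {R : Pred C r} {xs : List A} {ys : List B}
  (f : A → B → C) → (∀ {x y} → P x → Q y → R (f x y)) →
  All P xs → All Q ys → All R (concatMap (λ x → map (f x) ys) xs)
All-concatMap-map⁺ f R-f ps qs =
  Allₚ.concat⁺ (Allₚ.map⁺ (All.map (λ px → Allₚ.map⁺ (All.map (R-f px) qs)) ps))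

Any-concatMap-map⇔ : {P : Pred C p} (f : A → B → C) (xs : List A) (ys : List B) →
  Any P (concatMap (λ x → map (f x) ys) xs) ⇔ Any (λ x → Any (λ y → P (f x y)) ys) xs
Any-concatMap-map⇔ f xs ys =
  mk⇔ (Any.map Anyₚ.map⁻ ∘′ Anyₚ.concatMap⁻ _) (Anyₚ.concatMap⁺ _ ∘′ Any.map Anyₚ.map⁺)

All-choices⁺ : {P : Pred A p} {Q : Pred B q} {as : List A} {bs : List B} →
  All P as → All Q bs → All (All (P ⟨×⟩ Q)) (choices as bs)
All-choices⁺ []         qs = [] ∷ []
All-choices⁺ {as = a ∷ as} {bs} (pa ∷ pas) qs =
  All-concatMap-map⁺ (λ b g → (a , b) ∷ g) (λ qb g → (pa , qb) ∷ g) qs (All-choices⁺ pas qs)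

Any-All-choices⇔All-Any : {R : Pred (A × B) r} (as : List A) (bs : List B) →
  Any (All R) (choices as bs) ⇔ All (λ a → Any (λ b → R (a , b)) bs) as
Any-All-choices⇔All-Any []       bs = mk⇔ (λ _ → []) (λ _ → here [])
Any-All-choices⇔All-Any {R = R} (a ∷ as) bs = begin
  Any (All R) (choices (a ∷ as) bs)
    ≈⟨ Any-concatMap-map⇔ (λ b g → (a , b) ∷ g) bs (choices as bs) ⟩
  Any (λ b → Any (λ g → All R ((a , b) ∷ g)) (choices as bs)) bs
    ≈⟨ Any-cong⇔ (Any-cong⇔ All-∷⇔) ⟩
  Any (λ b → Any (λ g → R (a , b) × All R g) (choices as bs)) bs
    ≈⟨ ↔⇒⇔ Anyₚ.×↔ ⟨
  (Any (λ b → R (a , b)) bs × Any (All R) (choices as bs))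
    ≈⟨ ⇔.refl ×-⇔ Any-All-choices⇔All-Any as bs ⟩
  (Any (λ b → R (a , b)) bs × All (λ a → Any (λ b → R (a , b)) bs) as)
    ≈⟨ All-∷⇔ ⟨
  All (λ a → Any (λ b → R (a , b)) bs) (a ∷ as) ∎

module _ {Atom : Set} where

  ⋀F-closed : {P : Pred (Form Atom) p} → P (⊥f ⇒ ⊥f) → (∀ {φ ψ} → P φ → P ψ → P (φ ∧ ψ)) →
    ∀ {xs} → All P xs → P (⋀F xs)
  ⋀F-closed P-⊤ P-∧ []              = P-⊤
  ⋀F-closed P-⊤ P-∧ (px ∷ [])       = px
  ⋀F-closed P-⊤ P-∧ (px ∷ py ∷ pys) = P-∧ px (⋀F-closed P-⊤ P-∧ (py ∷ pys))

  All-ℛ-⇒⁺ : {P Q R : Pred (Form Atom) p} (φ ψ : Form Atom) →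
    (∀ {α β} → P α → Q β → R (α ⇒ β)) → R (⊥f ⇒ ⊥f) → (∀ {φ ψ} → R φ → R ψ → R (φ ∧ ψ)) →
    All P (ℛ φ) → All Q (ℛ ψ) → All R (ℛ (φ ⇒ ψ))
  All-ℛ-⇒⁺ {R = R} φ ψ R-⇒ R-⊤ R-∧ ps qs =
    Allₚ.map⁺ (All.map (λ g → ⋀F-closed {P = R} R-⊤ R-∧ (Allₚ.map⁺ (All.map (uncurry R-⇒) g)))
                       (All-choices⁺ ps qs))

  ℛ-declarative : ∀ φ → All Declarative (ℛ {Atom} φ)
  ℛ-declarative (atom p) = d-atom p ∷ []
  ℛ-declarative ⊥f       = d-⊥ ∷ []
  ℛ-declarative ⊙        = d-⊙ ∷ []
  ℛ-declarative (φ ⇛ ψ)  = d-⇛ φ ψ ∷ []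
  ℛ-declarative (φ ∧ ψ)  = All-concatMap-map⁺ _∧_ d-∧ (ℛ-declarative φ) (ℛ-declarative ψ)
  ℛ-declarative (φ ⩒ ψ)  = Allₚ.++⁺ (ℛ-declarative φ) (ℛ-declarative ψ)
  ℛ-declarative (φ ⇒ ψ)  = All-ℛ-⇒⁺ φ ψ d-⇒ (d-⇒ d-⊥ d-⊥) d-∧ (ℛ-declarative φ) (ℛ-declarative ψ)

  ℛ-md≤ : (p₀ : Atom) → ∀ φ → All (λ α → md p₀ α ≤ md p₀ φ) (ℛ φ)
  ℛ-md≤ p₀ (atom p) = ≤-refl ∷ []
  ℛ-md≤ p₀ ⊥f       = ≤-refl ∷ []
  ℛ-md≤ p₀ ⊙        = ≤-refl ∷ []
  ℛ-md≤ p₀ (φ ⇛ ψ)  = ≤-refl ∷ []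
  ℛ-md≤ p₀ (φ ∧ ψ)  = All-concatMap-map⁺ _∧_ ⊔-mono-≤ (ℛ-md≤ p₀ φ) (ℛ-md≤ p₀ ψ)
  ℛ-md≤ p₀ (φ ⩒ ψ)  =
    Allₚ.++⁺ (All.map (λ α≤φ → ≤-trans α≤φ (m≤m⊔n _ _)) (ℛ-md≤ p₀ φ))
             (All.map (λ β≤ψ → ≤-trans β≤ψ (m≤n⊔m _ _)) (ℛ-md≤ p₀ ψ))
  ℛ-md≤ p₀ (φ ⇒ ψ)  = All-ℛ-⇒⁺ φ ψ ⊔-mono-≤ z≤n ⊔-lub (ℛ-md≤ p₀ φ) (ℛ-md≤ p₀ ψ)

module _ {Atom : Set} (M : Model Atom) where

  persistent : ∀ φ {s t : Pred (W M) 0ℓ} → t ⊆ s → M , s ⊩ φ → M , t ⊩ φ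
  persistent (atom p) t⊆s s⊩p       = lift λ w tw → lower s⊩p w (t⊆s tw)
  persistent ⊥f       t⊆s s⊩⊥       = lift λ w tw → lower s⊩⊥ w (t⊆s tw)
  persistent ⊙        t⊆s s⊩⊙       = λ w tw → s⊩⊙ w (t⊆s tw)
  persistent (φ ∧ ψ)  t⊆s (s⊩φ , s⊩ψ) = persistent φ t⊆s s⊩φ , persistent ψ t⊆s s⊩ψ
  persistent (φ ⩒ ψ)  t⊆s s⊩φ⩒ψ     = Sum.map (persistent φ t⊆s) (persistent ψ t⊆s) s⊩φ⩒ψ
  persistent (φ ⇒ ψ)  t⊆s s⊩φ⇒ψ     = λ u u⊆t → s⊩φ⇒ψ u (t⊆s ∘′ u⊆t)
  persistent (φ ⇛ ψ)  t⊆s s⊩φ⇛ψ     = λ w tw → s⊩φ⇛ψ w (t⊆s tw)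

  ⊩⇒⊨ : ∀ {φ s v} → M , s ⊩ φ → s v → M , v ⊨ φ
  ⊩⇒⊨ {φ} s⊩φ sv = persistent φ (λ { refl → sv }) s⊩φ

  ⊨⇒⊩ : ∀ {α s} → Declarative α → (∀ v → s v → M , v ⊨ α) → M , s ⊩ α
  ⊨⇒⊩ (d-atom p)  ⊨α = lift λ w sw → lower (⊨α w sw) w refl
  ⊨⇒⊩ d-⊥         ⊨α = lift λ w sw → lower (⊨α w sw) w refl
  ⊨⇒⊩ d-⊙         ⊨α = λ w sw → ⊨α w sw w refl
  ⊨⇒⊩ (d-∧ dφ dψ) ⊨α = ⊨⇒⊩ dφ (λ v sv → proj₁ (⊨α v sv)) , ⊨⇒⊩ dψ (λ v sv → proj₂ (⊨α v sv))
  ⊨⇒⊩ (d-⇒ dφ dψ) ⊨α = λ t t⊆s t⊩φ → ⊨⇒⊩ dψ (λ v tv → ⊨α v (t⊆s tv) ⟦ v ⟧ id (⊩⇒⊨ t⊩φ tv))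
  ⊨⇒⊩ (d-⇛ φ ψ)   ⊨α = λ w sw → ⊨α w sw w refl

  ⊨-⇒⇔→ : ∀ {φ ψ w} → Declarative ψ → (M , w ⊨ (φ ⇒ ψ)) ⇔ (M , w ⊨ φ → M , w ⊨ ψ)
  ⊨-⇒⇔→ {φ} {ψ} {w} dψ = mk⇔
    (λ (w⊨φ⇒ψ : M , w ⊨ (φ ⇒ ψ)) → w⊨φ⇒ψ ⟦ w ⟧ id)
    (λ w⊨φ→w⊨ψ t t⊆w t⊩φ → ⊨⇒⊩ dψ λ v tv →
      subst (λ u → M , u ⊨ φ → M , u ⊨ ψ) (sym (t⊆w tv)) w⊨φ→w⊨ψ (⊩⇒⊨ t⊩φ tv))

  ⊩-⋀F : ∀ {s} xs → (M , s ⊩ ⋀F xs) ⇔ All (M , s ⊩_) xs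
  ⊩-⋀F []           = mk⇔ (λ _ → []) (λ _ _ _ → id)
  ⊩-⋀F (x ∷ [])     = mk⇔ (_∷ []) All.head
  ⊩-⋀F (x ∷ y ∷ ys) = ⇔.trans (⇔.refl ×-⇔ ⊩-⋀F (y ∷ ys)) (⇔.sym All-∷⇔)

  Any-ℛ-⇒⇔All-Any : ∀ {s} φ ψ →
    Any (M , s ⊩_) (ℛ (φ ⇒ ψ)) ⇔ All (λ α → Any (λ β → M , s ⊩ (α ⇒ β)) (ℛ ψ)) (ℛ φ)
  Any-ℛ-⇒⇔All-Any {s} φ ψ = ⇔.trans conjunctions (Any-All-choices⇔All-Any (ℛ φ) (ℛ ψ))
    where
    conjunctions :
      Any (M , s ⊩_) (ℛ (φ ⇒ ψ)) ⇔ Any (All (λ (α , β) → M , s ⊩ (α ⇒ β))) (choices (ℛ φ) (ℛ ψ))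
    conjunctions = mk⇔ (Any.map (Allₚ.map⁻ ∘′ to (⊩-⋀F _)) ∘′ Anyₚ.map⁻)
                       (Anyₚ.map⁺ ∘′ Any.map (from (⊩-⋀F _) ∘′ Allₚ.map⁺))

  Instances⇔All : ∀ {s} ρs → Instances M s ρs ⇔ All (λ ρ → ∃[ v ] s v × M , v ⊨I ρ) ρs
  Instances⇔All []       = mk⇔ (λ _ → []) (λ _ → lift tt)
  Instances⇔All (ρ ∷ ρs) = ⇔.trans (⇔.refl ×-⇔ Instances⇔All ρs) (⇔.sym All-∷⇔)

  module _ (p₀ : Atom) where

    ¬⊨I⊥⋆ : ∀ {w} → ¬ (M , w ⊨I ⊥⋆ p₀)
    ¬⊨I⊥⋆ (w⊨p₀ , w⊭p₀) = w⊭p₀ w⊨p₀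

    ⊨I-⋀I : ∀ {w} xs → (M , w ⊨I ⋀I p₀ xs) ⇔ All (M , w ⊨I_) xs
    ⊨I-⋀I []           = mk⇔ (λ _ → []) (λ _ → ¬⊨I⊥⋆)
    ⊨I-⋀I (x ∷ [])     = mk⇔ (_∷ []) All.head
    ⊨I-⋀I (x ∷ y ∷ ys) = ⇔.trans (⇔.refl ×-⇔ ⊨I-⋀I (y ∷ ys)) (⇔.sym All-∷⇔)

module _ (em : ExcludedMiddle (lsuc 0ℓ)) where

  dne : {P : Set₁} → ¬ ¬ P → P
  dne = decidable-stable em

  ¬∀⇔∃¬ : {X : Set} {s : Pred X 0ℓ} {P : X → Set₁} → (¬ (∀ x → s x → P x)) ⇔ (∃[ x ] s x × ¬ P x)
  ¬∀⇔∃¬ = mk⇔ (λ ¬∀ → dne λ ¬∃ → ¬∀ λ x sx → dne λ ¬Px → ¬∃ (x , sx , ¬Px))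
              (λ (x , sx , ¬Px) ∀P → ¬Px (∀P x sx))

  →⇔¬×¬ : {P Q : Set₁} → (P → Q) ⇔ (¬ (P × ¬ Q))
  →⇔¬×¬ = mk⇔ (λ P→Q (p , ¬q) → ¬q (P→Q p)) (λ ¬[P×¬Q] p → dne λ ¬q → ¬[P×¬Q] (p , ¬q))

  module _ {Atom : Set} (M : Model Atom) where

    -- M , v ⊨ α lives in Set₁; deciding it with em yields a proposition in Set,
    -- so s ↾ α is again a state.
    _↾_ : Pred (W M) 0ℓ → Form Atom → Pred (W M) 0ℓ
    (s ↾ α) v = s v × True (em {M , v ⊨ α})

    ↾-⊆ : ∀ s {α} → s ↾ α ⊆ s
    ↾-⊆ s (sv , _) = sv

    ↾-⊩ : ∀ {α s} → Declarative α → M , s ↾ α ⊩ α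
    ↾-⊩ dα = ⊨⇒⊩ M dα (λ v (_ , v⊨α) → toWitness v⊨α)

    ⊩-⇒⇔⊩↾ : ∀ {α β s} → Declarative α → (M , s ⊩ (α ⇒ β)) ⇔ (M , s ↾ α ⊩ β)
    ⊩-⇒⇔⊩↾ {α} {β} {s} dα = mk⇔
      (λ (s⊩α⇒β : M , s ⊩ (α ⇒ β)) → s⊩α⇒β (s ↾ α) (↾-⊆ s) (↾-⊩ dα))
      (λ s↾α⊩β t t⊆s t⊩α → persistent M β (λ tv → t⊆s tv , fromWitness (⊩⇒⊨ M t⊩α tv)) s↾α⊩β)

    ⊩-⇒⇔All-Any : ∀ {φ ψ s} →
      (∀ t → (M , t ⊩ φ) ⇔ Any (M , t ⊩_) (ℛ φ)) → (∀ t → (M , t ⊩ ψ) ⇔ Any (M , t ⊩_) (ℛ ψ)) →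
      (M , s ⊩ (φ ⇒ ψ)) ⇔ All (λ α → Any (λ β → M , s ⊩ (α ⇒ β)) (ℛ ψ)) (ℛ φ)
    ⊩-⇒⇔All-Any {φ} {ψ} {s} ℛφ ℛψ = mk⇔ choose combine
      where
      choose : M , s ⊩ (φ ⇒ ψ) → All (λ α → Any (λ β → M , s ⊩ (α ⇒ β)) (ℛ ψ)) (ℛ φ)
      choose s⊩φ⇒ψ = All.tabulate λ {α} α∈ℛφ →
        let dα     = All.lookup (ℛ-declarative φ) α∈ℛφ
            s↾α⊩ψ = s⊩φ⇒ψ (s ↾ α) (↾-⊆ s) (from (ℛφ (s ↾ α)) (lose α∈ℛφ (↾-⊩ dα)))
        in Any.map (from (⊩-⇒⇔⊩↾ dα)) (to (ℛψ (s ↾ α)) s↾α⊩ψ)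
      combine : All (λ α → Any (λ β → M , s ⊩ (α ⇒ β)) (ℛ ψ)) (ℛ φ) → M , s ⊩ (φ ⇒ ψ)
      combine choice t t⊆s t⊩φ =
        let (α , α∈ℛφ , t⊩α) = find (to (ℛφ t) t⊩φ)
        in from (ℛψ t) (Any.map (λ s⊩α⇒β → s⊩α⇒β t t⊆s t⊩α) (All.lookup choice α∈ℛφ))

    ⊩⇔Any-ℛ : ∀ φ s → (M , s ⊩ φ) ⇔ Any (M , s ⊩_) (ℛ φ)
    ⊩⇔Any-ℛ (atom p) s = mk⇔ Anyₚ.singleton⁺ Anyₚ.singleton⁻
    ⊩⇔Any-ℛ ⊥f       s = mk⇔ Anyₚ.singleton⁺ Anyₚ.singleton⁻
    ⊩⇔Any-ℛ ⊙        s = mk⇔ Anyₚ.singleton⁺ Anyₚ.singleton⁻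
    ⊩⇔Any-ℛ (φ ⇛ ψ)  s = mk⇔ Anyₚ.singleton⁺ Anyₚ.singleton⁻
    ⊩⇔Any-ℛ (φ ∧ ψ)  s = begin
      ((M , s ⊩ φ) × (M , s ⊩ ψ))                       ≈⟨ ⊩⇔Any-ℛ φ s ×-⇔ ⊩⇔Any-ℛ ψ s ⟩
      (Any (M , s ⊩_) (ℛ φ) × Any (M , s ⊩_) (ℛ ψ))     ≈⟨ ↔⇒⇔ Anyₚ.×↔ ⟩
      Any (λ α → Any (λ β → M , s ⊩ (α ∧ β)) (ℛ ψ)) (ℛ φ) ≈⟨ Any-concatMap-map⇔ _∧_ (ℛ φ) (ℛ ψ) ⟨
      Any (M , s ⊩_) (ℛ (φ ∧ ψ))                         ∎
    ⊩⇔Any-ℛ (φ ⩒ ψ)  s = ⇔.trans (⊩⇔Any-ℛ φ s ⊎-⇔ ⊩⇔Any-ℛ ψ s) (↔⇒⇔ Anyₚ.++↔)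
    ⊩⇔Any-ℛ (φ ⇒ ψ)  s =
      ⇔.trans (⊩-⇒⇔All-Any (⊩⇔Any-ℛ φ) (⊩⇔Any-ℛ ψ)) (⇔.sym (Any-ℛ-⇒⇔All-Any M φ ψ))

    Counterexample : W M → Form Atom → Form Atom → Set₁
    Counterexample w α ψ = ∃[ t ] N M w t × (M , t ⊩ α) × ¬ (M , t ⊩ ψ)

    ⊨-⇛⇔¬Counterexample : ∀ {w φ ψ} → (M , w ⊨ (φ ⇛ ψ)) ⇔ All (λ α → ¬ Counterexample w α ψ) (ℛ φ)
    ⊨-⇛⇔¬Counterexample {w} {φ} {ψ} = mk⇔ refute confirm
      where
      refute : M , w ⊨ (φ ⇛ ψ) → All (λ α → ¬ Counterexample w α ψ) (ℛ φ)
      refute w⊨φ⇛ψ = All.tabulate λ α∈ℛφ (t , wNt , t⊩α , t⊮ψ) →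
        t⊮ψ (w⊨φ⇛ψ w refl t wNt (from (⊩⇔Any-ℛ φ t) (lose α∈ℛφ t⊩α)))
      confirm : All (λ α → ¬ Counterexample w α ψ) (ℛ φ) → M , w ⊨ (φ ⇛ ψ)
      confirm none _ refl t wNt t⊩φ = dne λ t⊮ψ →
        let (α , α∈ℛφ , t⊩α) = find (to (⊩⇔Any-ℛ φ t) t⊩φ)
        in All.lookup none α∈ℛφ (t , wNt , t⊩α , t⊮ψ)

    module _ (p₀ : Atom) where

      Faithful : ℕ → Form Atom → Set₁
      Faithful n α = ∀ w → (M , w ⊨ α) ⇔ (M , w ⊨I tr p₀ n α)

      atom-faithful : ∀ {p} w → (M , w ⊨ atom p) ⇔ (M , w ⊨I iatom p)
      atom-faithful w =
        mk⇔ (λ w⊨p → lift (lower w⊨p w refl)) (λ w⊨p → lift λ { _ refl → lower w⊨p })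

      ⊥-faithful : ∀ w → (M , w ⊨ ⊥f) ⇔ (M , w ⊨I ⊥⋆ p₀)
      ⊥-faithful w = mk⇔ (λ w⊨⊥ → ⊥-elim (lower w⊨⊥ w refl)) (λ w⊨⊥⋆ → ⊥-elim (¬⊨I⊥⋆ M p₀ w⊨⊥⋆))

      ⊙-faithful : ∀ w → (M , w ⊨ ⊙) ⇔ (M , w ⊨I □ [] (⊥⋆ p₀))
      ⊙-faithful w = mk⇔ (λ w⊨⊙ → empty⇒□ (w⊨⊙ w refl)) (λ w⊨□ → λ { _ refl → □⇒empty w⊨□ })
        where
        empty⇒□ : EmptyIn M w → M , w ⊨I □ [] (⊥⋆ p₀)
        empty⇒□ (t , wNt , lift t-empty) = t , wNt , (λ v tv → ⊥-elim (t-empty v tv)) , lift tt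
        □⇒empty : M , w ⊨I □ [] (⊥⋆ p₀) → EmptyIn M w
        □⇒empty (t , wNt , t⊨⊥⋆ , _) = t , wNt , lift λ v tv → ¬⊨I⊥⋆ M p₀ (t⊨⊥⋆ v tv)

      ∧-faithful : ∀ {n φ ψ} → Faithful n φ → Faithful n ψ → Faithful n (φ ∧ ψ)
      ∧-faithful φ-faithful ψ-faithful w = φ-faithful w ×-⇔ ψ-faithful w

      ⇒-faithful : ∀ {n φ ψ} → Declarative ψ → Faithful n φ → Faithful n ψ → Faithful n (φ ⇒ ψ)
      ⇒-faithful {n} {φ} {ψ} dψ φ-faithful ψ-faithful w = begin
        M , w ⊨ (φ ⇒ ψ)                           ≈⟨ ⊨-⇒⇔→ M dψ ⟩
        (M , w ⊨ φ → M , w ⊨ ψ)                   ≈⟨ →-cong-⇔ (φ-faithful w) (ψ-faithful w) ⟩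
        (M , w ⊨I tr p₀ n φ → M , w ⊨I tr p₀ n ψ) ≈⟨ →⇔¬×¬ ⟩
        M , w ⊨I tr p₀ n (φ ⇒ ψ)                  ∎

      module _ {n : ℕ} (IH : ∀ {α} → Declarative α → md p₀ α ≤ n → Faithful n α) where

        ⊩⇔∀⊨I-ℛ : ∀ φ {α t} → md p₀ φ ≤ n → α ∈ ℛ φ → (M , t ⊩ α) ⇔ (∀ v → t v → M , v ⊨I tr p₀ n α)
        ⊩⇔∀⊨I-ℛ φ φ≤n α∈ℛφ = mk⇔
          (λ t⊩α v tv → to (α-faithful v) (⊩⇒⊨ M t⊩α tv))
          (λ t⊨α⋆ → ⊨⇒⊩ M dα λ v tv → from (α-faithful v) (t⊨α⋆ v tv))
          where
          dα = All.lookup (ℛ-declarative φ) α∈ℛφ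
          α-faithful = IH dα (≤-trans (All.lookup (ℛ-md≤ p₀ φ) α∈ℛφ) φ≤n)

        □⇔Counterexample : ∀ φ ψ {α w} → md p₀ φ ≤ n → md p₀ ψ ≤ n → α ∈ ℛ φ →
          (M , w ⊨I □ (map (λ β → ¬i (tr p₀ n β)) (ℛ ψ)) (tr p₀ n α)) ⇔ Counterexample w α ψ
        □⇔Counterexample φ ψ φ≤n ψ≤n α∈ℛφ =
          ∃-cong {k = equivalence} (⇔.refl ×-⇔ ⇔.sym (⊩⇔∀⊨I-ℛ φ φ≤n α∈ℛφ) ×-⇔ no-instance⇔⊮ψ)
          where
          no-instance⇔⊮ψ : ∀ {t} → Instances M t (map (λ β → ¬i (tr p₀ n β)) (ℛ ψ)) ⇔ (¬ M , t ⊩ ψ)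
          no-instance⇔⊮ψ {t} = begin
            Instances M t (map (λ β → ¬i (tr p₀ n β)) (ℛ ψ))
              ≈⟨ Instances⇔All M _ ⟩
            All (λ ρ → ∃[ v ] t v × M , v ⊨I ρ) (map (λ β → ¬i (tr p₀ n β)) (ℛ ψ))
              ≈⟨ All-map⇔ ⟨
            All (λ β → ∃[ v ] t v × ¬ M , v ⊨I tr p₀ n β) (ℛ ψ)
              ≈⟨ All-cong∈⇔ (λ β∈ℛψ → ⇔.trans (¬-cong-⇔ (⊩⇔∀⊨I-ℛ ψ ψ≤n β∈ℛψ)) ¬∀⇔∃¬) ⟨
            All (λ β → ¬ M , t ⊩ β) (ℛ ψ)
              ≈⟨ All¬⇔¬Any ⟩
            (¬ Any (M , t ⊩_) (ℛ ψ))
              ≈⟨ ¬-cong-⇔ (⊩⇔Any-ℛ ψ t) ⟨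
            (¬ M , t ⊩ ψ) ∎

        ⇛-faithful : ∀ φ ψ → md p₀ φ ≤ n → md p₀ ψ ≤ n → Faithful (suc n) (φ ⇛ ψ)
        ⇛-faithful φ ψ φ≤n ψ≤n w = begin
          M , w ⊨ (φ ⇛ ψ)
            ≈⟨ ⊨-⇛⇔¬Counterexample ⟩
          All (λ α → ¬ Counterexample w α ψ) (ℛ φ)
            ≈⟨ All-cong∈⇔ (λ α∈ℛφ → ¬-cong-⇔ (□⇔Counterexample φ ψ φ≤n ψ≤n α∈ℛφ)) ⟨
          All (λ α → ¬ M , w ⊨I □ (map (λ β → ¬i (tr p₀ n β)) (ℛ ψ)) (tr p₀ n α)) (ℛ φ)
            ≈⟨ All-map⇔ ⟩
          All (M , w ⊨I_) (map (λ α → ¬i (□ (map (λ β → ¬i (tr p₀ n β)) (ℛ ψ)) (tr p₀ n α))) (ℛ φ))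
            ≈⟨ ⊨I-⋀I M p₀ _ ⟨
          M , w ⊨I tr p₀ (suc n) (φ ⇛ ψ) ∎

      faithful : ∀ n α → Declarative α → md p₀ α ≤ n → Faithful n α
      faithful n (atom p) _ _ = atom-faithful
      faithful n ⊥f       _ _ = ⊥-faithful
      faithful n ⊙        _ _ = ⊙-faithful
      faithful n (φ ∧ ψ) (d-∧ dφ dψ) φ∧ψ≤n =
        ∧-faithful (faithful n φ dφ (m⊔n≤o⇒m≤o _ _ φ∧ψ≤n)) (faithful n ψ dψ (m⊔n≤o⇒n≤o _ _ φ∧ψ≤n))
      faithful n (φ ⇒ ψ) (d-⇒ dφ dψ) φ⇒ψ≤n =
        ⇒-faithful dψ (faithful n φ dφ (m⊔n≤o⇒m≤o _ _ φ⇒ψ≤n))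
                      (faithful n ψ dψ (m⊔n≤o⇒n≤o _ _ φ⇒ψ≤n))
      faithful (suc n) (φ ⇛ ψ) _ (s≤s φ⊔ψ≤n) =
        ⇛-faithful (λ {α} → faithful n α) φ ψ (m⊔n≤o⇒m≤o _ _ φ⊔ψ≤n) (m⊔n≤o⇒n≤o _ _ φ⊔ψ≤n)

proposition9p2 : {Atom : Set} (p₀ : Atom) → ExcludedMiddle (lsuc 0ℓ) →
    (α : Form Atom) → Declarative α →
    (M : Model Atom) (w : W M) →
    (M , w ⊨ α) ⇔ (M , w ⊨I _⋆ p₀ α)
proposition9p2 p₀ em α dα M = faithful em M p₀ (md p₀ α) α dα ≤-refl
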